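{- Let $G$ be a graph with Hamilton cycle $H$ and auxiliary graph $A=A(G,H)$. If $C\subseteq A$ is a non-empty colour-alternating cycle of length $L$ without neighbouring vertices, then the $2$-factor $F(C)$ has at most $L$ components.
   Context: For a graph $G$ on $n$ vertices with Hamilton cycle $H=v_1v_2\dots v_nv_1$ (indices mod $n$), write $e_i=v_iv_{i+1}$; an inner edge is an edge of $G$ not in $H$. The auxiliary graph $A(G,H)$ is the $2$-edge-coloured graph on $\{e_1,\dots,e_n\}$ with a red edge $e_ie_j$ iff $v_{i+1}v_{j+1}$ is an inner edge of $G$ and a blue edge $e_ie_j$ iff $v_iv_j$ is an inner edge (a pair may get both colours). For a red edge $\ell=e_ie_j$ put $e(\ell)=v_{i+1}v_{j+1}$; for a blue one $e(\ell)=v_iv_j$. A colour-alternating cycle in $A$ is a cycle in which every vertex is incident to exactly one red and one blue edge of the cycle (a red and a blue edge on the same pair form a colour-alternating cycle of length $2$). It has no neighbouring vertices if no two of its vertices are $e_i,e_{i+1}$ (indices mod $n$). For such $C$, $F(C)$ is the spanning subgraph of $G$ with edge set $(\{e_1,\dots,e_n\}\setminus V(C))\cup\{e(\ell):\ell\in E(C)\}$, a $2$-factor of $G$. -}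

module Defs where

open import Level using (0ℓ)
open import Data.Nat using (ℕ; suc; _%_; _≤_; _*_)
open import Data.Nat.DivMod using (m%n<n)
open import Data.Fin using (Fin; toℕ; fromℕ<)
open import Data.Product using (Σ; _×_; ∃; ∃-syntax; _,_)
open import Data.Sum using (_⊎_)
open import Relation.Nullary using (¬_)
open import Relation.Binary.PropositionalEquality using (_≡_; _≢_)
open import Relation.Binary.Construct.Closure.ReflexiveTransitive using (Star)
open import Function.Definitions using (Injective)

next : ∀ {m} → Fin (suc m) → Fin (suc m)
next {m} i = fromℕ< (m%n<n (suc (toℕ i)) (suc m))

record Graph (n : ℕ) : Set₁ where
  field
    Adj   : Fin n → Fin n → Set
    sym   : ∀ {x y} → Adj x y → Adj y x
    irrefl : ∀ {x} → ¬ Adj x x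
open Graph public

SameEdge : ∀ {n} → Fin n → Fin n → Fin n → Fin n → Set
SameEdge x y a b = (x ≡ a × y ≡ b) ⊎ (x ≡ b × y ≡ a)

record HamiltonCycle {m : ℕ} (G : Graph (suc m)) : Set where
  field
    v     : Fin (suc m) → Fin (suc m)
    v-inj : Injective _≡_ _≡_ v
    v-adj : ∀ i → Adj G (v i) (v (next i))
open HamiltonCycle public

module _ {m : ℕ} (G : Graph (suc m)) (H : HamiltonCycle G) where

  InH : Fin (suc m) → Fin (suc m) → Set
  InH x y = ∃[ k ] SameEdge x y (v H k) (v H (next k))

  Inner : Fin (suc m) → Fin (suc m) → Set
  Inner x y = Adj G x y × ¬ InH x y

  -- edges of the auxiliary graph A(G,H) on {e_i} (e_i identified with index i)
  Red : Fin (suc m) → Fin (suc m) → Set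
  Red i j = Inner (v H (next i)) (v H (next j))

  Blue : Fin (suc m) → Fin (suc m) → Set
  Blue i j = Inner (v H i) (v H j)

  -- A colour-alternating cycle of length L = 2 * suc k in A(G,H):
  -- distinct vertices c₀ … c_{L-1} (indices of edges e_{c_j}), with the cycle edge
  -- c_j c_{j+1 mod L} red for j even and blue for j odd.
  -- (For L = 2 this is a red and a blue edge on the same pair.)
  record AltCycle (k : ℕ) : Set where
    field
      c      : Fin (2 * suc k) → Fin (suc m)
      c-inj  : Injective _≡_ _≡_ c
      c-red  : ∀ j → toℕ j % 2 ≡ 0 → Red  (c j) (c (next j))
      c-blue : ∀ j → toℕ j % 2 ≡ 1 → Blue (c j) (c (next j))
  open AltCycle public

  NoNeighbours : ∀ {k} → AltCycle k → Set
  NoNeighbours C = ∀ a b → c C b ≢ next (c C a)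

  IsEℓ : ∀ {k} → AltCycle k → Fin (2 * suc k) → Fin (suc m) → Fin (suc m) → Set
  IsEℓ C j x y =
    (toℕ j % 2 ≡ 0 × SameEdge x y (v H (next (c C j))) (v H (next (c C (next j)))))
    ⊎ (toℕ j % 2 ≡ 1 × SameEdge x y (v H (c C j)) (v H (c C (next j))))

  FEdge : ∀ {k} → AltCycle k → Fin (suc m) → Fin (suc m) → Set
  FEdge C x y =
    (∃[ i ] (¬ (∃[ j ] c C j ≡ i)) × SameEdge x y (v H i) (v H (next i)))
    ⊎ (∃[ j ] IsEℓ C j x y)

  Connected-F : ∀ {k} → AltCycle k → Fin (suc m) → Fin (suc m) → Set
  Connected-F C = Star (FEdge C)

  -- F(C) has at most N components: there are N vertices meeting every component
  AtMostComponents : ∀ {k} → AltCycle k → ℕ → Set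
  AtMostComponents C N = Σ (Fin N → Fin (suc m)) λ r → ∀ x → ∃[ t ] Connected-F C (r t) x

-- Removing the edges e_c (c ∈ V(C)) cuts the Hamilton cycle H into at most L arcs, each
-- starting at a vertex v_{c+1}; every arc consists of kept edges of H, which are edges of
-- F(C). Hence walking forward along H from any vertex leads back to the start of its arc,
-- and the L vertices v_{c+1} meet every component of F(C).
module Submission where

open import Defs
open import Data.Nat using (ℕ; zero; suc; _≤_; _*_; _+_; _∸_; _%_)
open import Data.Nat.Properties using (+-suc; +-comm; +-assoc; +-identityʳ; m+[n∸m]≡n; <⇒≤; 1+n≰n)
open import Data.Nat.DivMod using (m%n%n≡m%n; %-distribˡ-+; [m+n]%n≡m%n; m<n⇒m%n≡m)
open import Data.Fin as Fin using (Fin; toℕ; punchOut)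
open import Data.Fin.Properties using (toℕ-fromℕ<; toℕ-injective; toℕ<n; any?; _≟_; punchOut-injective; injective⇒≤)
open import Data.Empty using (⊥-elim)
open import Data.Product using (∃-syntax; _,_; proj₁; proj₂)
open import Data.Sum using (_⊎_; inj₁; inj₂)
open import Relation.Nullary using (yes; no)
open import Relation.Binary.PropositionalEquality using (_≡_; _≢_; refl; cong; subst; module ≡-Reasoning)
  renaming (sym to ≡-sym)
open import Relation.Binary.Construct.Closure.ReflexiveTransitive using (ε; _◅_; _◅◅_)
open import Function.Definitions using (Injective; Surjective)

injective⇒surjective : ∀ {n} {f : Fin n → Fin n} → Injective _≡_ _≡_ f → Surjective _≡_ _≡_ f
injective⇒surjective {suc n} {f} f-inj y with any? (λ x → f x ≟ y)
... | yes (x , fx≡y) = x , λ { refl → fx≡y }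
... | no ∄x = ⊥-elim (1+n≰n (injective⇒≤ {f = avoid-y} avoid-y-injective))
  where
  y≢f : ∀ x → y ≢ f x
  y≢f x y≡fx = ∄x (x , ≡-sym y≡fx)

  avoid-y : Fin (suc n) → Fin n
  avoid-y x = punchOut (y≢f x)

  avoid-y-injective : Injective _≡_ _≡_ avoid-y
  avoid-y-injective {x} {x′} eq = f-inj (punchOut-injective (y≢f x) (y≢f x′) eq)

next^ : ∀ {m} → ℕ → Fin (suc m) → Fin (suc m)
next^ zero    a = a
next^ (suc s) a = next (next^ s a)

toℕ-next^ : ∀ {m} s (a : Fin (suc m)) → toℕ (next^ s a) ≡ (toℕ a + s) % suc m
toℕ-next^ {m} zero a = begin
  toℕ a                ≡⟨ ≡-sym (m<n⇒m%n≡m (toℕ<n a)) ⟩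
  toℕ a % suc m        ≡⟨ cong (_% suc m) (≡-sym (+-identityʳ (toℕ a))) ⟩
  (toℕ a + 0) % suc m  ∎
  where open ≡-Reasoning
toℕ-next^ {m} (suc s) a = begin
  toℕ (next (next^ s a))      ≡⟨ toℕ-fromℕ< _ ⟩
  suc (toℕ (next^ s a)) % n   ≡⟨ cong (λ z → suc z % n) (toℕ-next^ s a) ⟩
  (1 + x % n) % n             ≡⟨ %-distribˡ-+ 1 (x % n) n ⟩
  (1 % n + x % n % n) % n     ≡⟨ cong (λ z → (1 % n + z) % n) (m%n%n≡m%n x n) ⟩
  (1 % n + x % n) % n         ≡⟨ ≡-sym (%-distribˡ-+ 1 x n) ⟩
  (1 + x) % n                 ≡⟨ cong (_% n) (≡-sym (+-suc (toℕ a) s)) ⟩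
  (toℕ a + suc s) % n         ∎
  where
  open ≡-Reasoning
  n = suc m
  x = toℕ a + s

next^-reaches : ∀ {m} (a i : Fin (suc m)) → ∃[ s ] next^ s a ≡ i
next^-reaches {m} a i = s , toℕ-injective (begin
  toℕ (next^ s a)                               ≡⟨ toℕ-next^ s a ⟩
  (toℕ a + ((n ∸ toℕ a) + toℕ i)) % n           ≡⟨ cong (_% n) (≡-sym (+-assoc (toℕ a) _ (toℕ i))) ⟩
  ((toℕ a + (n ∸ toℕ a)) + toℕ i) % n           ≡⟨ cong (λ z → (z + toℕ i) % n) (m+[n∸m]≡n (<⇒≤ (toℕ<n a))) ⟩
  (n + toℕ i) % n                               ≡⟨ cong (_% n) (+-comm n (toℕ i)) ⟩
  (toℕ i + n) % n                               ≡⟨ [m+n]%n≡m%n (toℕ i) n ⟩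
  toℕ i % n                                     ≡⟨ m<n⇒m%n≡m (toℕ<n i) ⟩
  toℕ i                                         ∎)
  where
  open ≡-Reasoning
  n = suc m
  s = (n ∸ toℕ a) + toℕ i

next-closed⇒universal : ∀ {m} (P : Fin (suc m) → Set) {a : Fin (suc m)} → P a
  → (∀ i → P i → P (next i)) → ∀ i → P i
next-closed⇒universal P {a} Pa P-next i with next^-reaches a i
... | s , refl = P-next^ s
  where
  P-next^ : ∀ s → P (next^ s a)
  P-next^ zero    = Pa
  P-next^ (suc s) = P-next _ (P-next^ s)

module _ {m} {G : Graph (suc m)} (H : HamiltonCycle G) {k} (C : AltCycle G H k) where

  arcStart : Fin (2 * suc k) → Fin (suc m)
  arcStart t = v H (next (c C t))

  ReachedFromArcStart : Fin (suc m) → Set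
  ReachedFromArcStart x = ∃[ t ] Connected-F G H C (arcStart t) x

  kept-or-arcStart : ∀ i → FEdge G H C (v H i) (v H (next i)) ⊎ ∃[ t ] arcStart t ≡ v H (next i)
  kept-or-arcStart i with any? (λ j → c C j ≟ i)
  ... | yes (t , refl) = inj₂ (t , refl)
  ... | no i∉C         = inj₁ (inj₁ (i , i∉C , inj₁ (refl , refl)))

  reached-next : ∀ i → ReachedFromArcStart (v H i) → ReachedFromArcStart (v H (next i))
  reached-next i (t , path) with kept-or-arcStart i
  ... | inj₁ eᵢ        = t , path ◅◅ (eᵢ ◅ ε)
  ... | inj₂ (t′ , eq) = t′ , subst (Connected-F G H C (arcStart t′)) eq ε

  reached-everywhere : ∀ x → ReachedFromArcStart x
  reached-everywhere x = subst ReachedFromArcStart (proj₂ v-onto refl) (reached (proj₁ v-onto))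
    where
    v-onto : ∃[ i ] (∀ {j} → j ≡ i → v H j ≡ x)
    v-onto = injective⇒surjective (v-inj H) x

    reached : ∀ i → ReachedFromArcStart (v H i)
    reached = next-closed⇒universal (λ i → ReachedFromArcStart (v H i))
                (Fin.zero , ε) reached-next

mainTheorem9 : (m : ℕ) → 2 ≤ m → (G : Graph (suc m)) → (H : HamiltonCycle G)
    → (k : ℕ) → (C : AltCycle G H k) → NoNeighbours G H C
    → AtMostComponents G H C (2 * suc k)
mainTheorem9 m _ G H k C _ = arcStart H C , reached-everywhere H C
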